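{- In the free PreLie algebra on a vector space $V$ (with basis the rooted non-planar trees whose vertices are labelled by basis elements of $V$), for every rooted tree $T$ with $n$ vertices and every rooted tree $S$, $$\Delta(T\curvearrowleft S)=n\,T\otimes S+\sum_{a\in E(S)}(T\curvearrowleft R_a(S))\otimes L_a(S)+\sum_{a\in E(T)}(R_a(T)\curvearrowleft S)\otimes L_a(T)+\sum_{a\in E(T)}R_a(T)\otimes(L_a(T)\curvearrowleft S).$$
   Context: The PreLie product $T\curvearrowleft S$ of rooted trees is the sum, over all vertices $v$ of $T$, of the tree obtained by adding an edge between $v$ and the root of $S$, rooted at the root of $T$; extended bilinearly. For a rooted tree $T$ with edge set $E(T)$ and $a\in E(T)$, $R_a(T)$ denotes the connected component of $T\setminus\{a\}$ containing the root of $T$ (rooted there) and $L_a(T)$ the other component (rooted at the endpoint of $a$ it contains). The coproduct dual to the PreLie product in this basis is $\Delta(T)=\sum_{a\in E(T)}R_a(T)\otimes L_a(T)$, extended linearly. -}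

module Defs where

open import Data.Nat using (ℕ; suc; _+_)
open import Data.List using (List; []; _∷_; map; _++_; concatMap; replicate; sum)
open import Data.Product using (_×_; _,_)
open import Relation.Binary.PropositionalEquality using (_≡_)
open import Data.List.Relation.Binary.Permutation.Homogeneous using (Permutation)

-- Rooted trees with vertices labelled by elements of L (a basis of V).
-- Planar representatives; non-planar trees are these modulo _≅_ below.
data Tree (L : Set) : Set where
  node : L → List (Tree L) → Tree L

data _≅_ {L : Set} : Tree L → Tree L → Set where
  node≅ : ∀ {a b ts us} → a ≡ b → Permutation _≅_ ts us → node a ts ≅ node b us

-- Elements of the free module with basis B are represented by finite formal
-- sums with natural multiplicities, i.e. lists of basis elements;
-- two such are equal iff they agree as multisets up to the basis equivalence.
Lin : Set → Set
Lin B = List B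

_≈₁_ : {L : Set} → Lin (Tree L) → Lin (Tree L) → Set
_≈₁_ = Permutation _≅_

_≅²_ : {L : Set} → Tree L × Tree L → Tree L × Tree L → Set
(a , b) ≅² (c , d) = (a ≅ c) × (b ≅ d)

_≈₂_ : {L : Set} → Lin (Tree L × Tree L) → Lin (Tree L × Tree L) → Set
_≈₂_ = Permutation _≅²_

mutual
  size : {L : Set} → Tree L → ℕ
  size (node _ ts) = suc (sizeF ts)

  sizeF : {L : Set} → List (Tree L) → ℕ
  sizeF [] = 0
  sizeF (t ∷ ts) = size t + sizeF ts

-- PreLie product T ↶ S : sum over vertices v of T of grafting S onto v.
mutual
  _↶_ : {L : Set} → Tree L → Tree L → Lin (Tree L)
  node a ts ↶ S = node a (S ∷ ts) ∷ map (node a) (graftF ts S)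

  graftF : {L : Set} → List (Tree L) → Tree L → List (List (Tree L))
  graftF [] S = []
  graftF (t ∷ ts) S = map (_∷ ts) (t ↶ S) ++ map (t ∷_) (graftF ts S)

-- Edge cuts: for each edge a of T, the pair (R_a(T), L_a(T)).
mutual
  cuts : {L : Set} → Tree L → List (Tree L × Tree L)
  cuts (node a ts) = map (λ { (rs , l) → (node a rs , l) }) (cutsF ts)

  cutsF : {L : Set} → List (Tree L) → List (List (Tree L) × Tree L)
  cutsF [] = []
  cutsF (t ∷ ts) =
    (ts , t) ∷ (map (λ { (r , l) → (r ∷ ts , l) }) (cuts t)
               ++ map (λ { (rs , l) → (t ∷ rs , l) }) (cutsF ts))

Δ : {L : Set} → Lin (Tree L) → Lin (Tree L × Tree L)
Δ = concatMap cuts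

_↶ₗ_ : {L : Set} → Lin (Tree L) → Tree L → Lin (Tree L)
xs ↶ₗ S = concatMap (_↶ S) xs

rhs : {L : Set} → Tree L → Tree L → Lin (Tree L × Tree L)
rhs T S =
  replicate (size T) (T , S)
  ++ concatMap (λ { (r , l) → map (λ x → (x , l)) (T ↶ r) }) (cuts S)
  ++ concatMap (λ { (r , l) → map (λ x → (x , l)) (r ↶ S) }) (cuts T)
  ++ concatMap (λ { (r , l) → map (λ x → (r , x)) (l ↶ S) }) (cuts T)

-- Cutting an edge e of the tree obtained by grafting S at a vertex v of T gives T ⊗ S when e is
-- the new edge, (T ↶ᵥ Rₑ S) ⊗ Lₑ S when e lies in S, and (Rₑ T ↶ᵥ S) ⊗ Lₑ T or Rₑ T ⊗ (Lₑ T ↶ᵥ S)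
-- when e lies in T, according to the side of e on which v lies.  Formally this is a simultaneous
-- induction on trees and forests, a forest standing for a tree with a virtual root above it.
-- The identity already holds up to permutation of planar representatives, so ≅ enters only
-- through its reflexivity.
module Submission where

open import Defs
open import Data.Nat using (ℕ; zero; suc; _+_)
open import Data.List using (List; []; _∷_; map; _++_; concatMap; replicate)
open import Data.List.Properties
  using (map-++; map-∘; ++-identityʳ; map-replicate; concatMap-cong; concatMap-map; map-concatMap; concatMap-++)
open import Data.Product using (_×_; _,_; map₁)
open import Function using (_∘_)
open import Relation.Binary.PropositionalEquality using (_≡_; refl; cong; cong₂; sym; trans)
open import Data.List.Relation.Binary.Permutation.Propositional
  using (_↭_; ↭-refl; ↭-reflexive; ↭-trans; ↭-sym; prep; ↭⇒↭ₛ; module PermutationReasoning)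
open import Data.List.Relation.Binary.Permutation.Propositional.Properties
  using (++⁺; ++⁺ˡ; ++⁺ʳ; map⁺; ++-commutativeMonoid)
import Data.List.Relation.Binary.Permutation.Homogeneous as Homogeneous
open import Data.List.Relation.Binary.Pointwise using (Pointwise; []; _∷_)
import Algebra.Solver.CommutativeMonoid as CommutativeMonoidSolver

private
  variable
    A B C D : Set

replicate-+ : (m n : ℕ) (x : A) → replicate (m + n) x ≡ replicate m x ++ replicate n x
replicate-+ zero    n x = refl
replicate-+ (suc m) n x = cong (x ∷_) (replicate-+ m n x)

module _ {B : Set} where
  open CommutativeMonoidSolver (++-commutativeMonoid {A = B})

  concatMap-∷-↭ : (f : A → B) (g : A → List B) (xs : List A) →
    concatMap (λ x → f x ∷ g x) xs ↭ map f xs ++ concatMap g xs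
  concatMap-∷-↭ f g []       = ↭-refl
  concatMap-∷-↭ f g (x ∷ xs) = prep (f x) (↭-trans (++⁺ˡ (g x) (concatMap-∷-↭ f g xs))
    (solve 3 (λ gx fs gs → gx ⊕ (fs ⊕ gs) ⊜ fs ⊕ (gx ⊕ gs)) ↭-refl (g x) (map f xs) (concatMap g xs)))

  concatMap-++-↭ : (f g : A → List B) (xs : List A) →
    concatMap (λ x → f x ++ g x) xs ↭ concatMap f xs ++ concatMap g xs
  concatMap-++-↭ f g []       = ↭-refl
  concatMap-++-↭ f g (x ∷ xs) = ↭-trans (++⁺ˡ (f x ++ g x) (concatMap-++-↭ f g xs))
    (solve 4 (λ fx gx fs gs → (fx ⊕ gx) ⊕ (fs ⊕ gs) ⊜ (fx ⊕ fs) ⊕ (gx ⊕ gs)) ↭-refl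
      (f x) (g x) (concatMap f xs) (concatMap g xs))

concatMap-const-[] : (xs : List A) → concatMap {B = B} (λ _ → []) xs ≡ []
concatMap-const-[] []       = refl
concatMap-const-[] (x ∷ xs) = concatMap-const-[] xs

concatMap-map-comm : (f : A → B → C) (xs : List A) (ys : List B) →
  concatMap (λ x → map (f x) ys) xs ↭ concatMap (λ y → map (λ x → f x y) xs) ys
concatMap-map-comm f []       ys = ↭-reflexive (sym (concatMap-const-[] ys))
concatMap-map-comm f (x ∷ xs) ys = ↭-trans (++⁺ˡ (map (f x) ys) (concatMap-map-comm f xs ys))
  (↭-sym (concatMap-∷-↭ (f x) (λ y → map (λ x → f x y) xs) ys))

concatMap₁ : (A → List B) → List (A × C) → List (B × C)
concatMap₁ f = concatMap (λ (a , c) → map (_, c) (f a))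

concatMap₂ : (B → List C) → List (A × B) → List (A × C)
concatMap₂ f = concatMap (λ (a , b) → map (a ,_) (f b))

concatMap₁-map₁ : (f : B → List C) (g : A → B) (ps : List (A × D)) →
  concatMap₁ f (map (map₁ g) ps) ≡ concatMap₁ (f ∘ g) ps
concatMap₁-map₁ f g = concatMap-map _ (map₁ g)

map-map₁-concatMap₁ : (g : B → C) (f : A → List B) (ps : List (A × D)) →
  map (map₁ g) (concatMap₁ f ps) ≡ concatMap₁ (map g ∘ f) ps
map-map₁-concatMap₁ g f ps = trans (map-concatMap (map₁ g) _ ps)
  (concatMap-cong (λ (a , _) → trans (sym (map-∘ (f a))) (map-∘ (f a))) ps)

map-map₁-concatMap₂ : (g : A → B) (f : C → List D) (ps : List (A × C)) →
  map (map₁ g) (concatMap₂ f ps) ≡ concatMap₂ f (map (map₁ g) ps)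
map-map₁-concatMap₂ g f ps = trans (map-concatMap (map₁ g) _ ps)
  (trans (concatMap-cong (λ (_ , c) → sym (map-∘ (f c))) ps) (sym (concatMap-map _ (map₁ g) ps)))

concatMap₁-∷ : (f : A → B) (g : A → List B) (ps : List (A × C)) →
  concatMap₁ (λ a → f a ∷ g a) ps ↭ map (map₁ f) ps ++ concatMap₁ g ps
concatMap₁-∷ f g = concatMap-∷-↭ (map₁ f) _

concatMap₁-++ : (f g : A → List B) (ps : List (A × C)) →
  concatMap₁ (λ a → f a ++ g a) ps ↭ concatMap₁ f ps ++ concatMap₁ g ps
concatMap₁-++ f g ps = ↭-trans
  (↭-reflexive (concatMap-cong (λ (a , c) → map-++ (_, c) (f a) (g a)) ps))
  (concatMap-++-↭ _ _ ps)

map-map₁-terms : (g : A → B) (n : ℕ) (x : A × C) (f : D → List A) (ps : List (D × C))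
  (f′ : A → List A) (f″ : C → List C) (qs : List (A × C)) →
  map (map₁ g) (replicate n x ++ concatMap₁ f ps ++ concatMap₁ f′ qs ++ concatMap₂ f″ qs)
  ≡ replicate n (map₁ g x) ++ concatMap₁ (map g ∘ f) ps ++ concatMap₁ (map g ∘ f′) qs
    ++ concatMap₂ f″ (map (map₁ g) qs)
map-map₁-terms g n x f ps f′ f″ qs =
  trans (map-++ (map₁ g) (replicate n x) _) (cong₂ _++_ (map-replicate (map₁ g) n x)
  (trans (map-++ (map₁ g) (concatMap₁ f ps) _) (cong₂ _++_ (map-map₁-concatMap₁ g f ps)
  (trans (map-++ (map₁ g) (concatMap₁ f′ qs) _) (cong₂ _++_ (map-map₁-concatMap₁ g f′ qs)
    (map-map₁-concatMap₂ g f″ qs))))))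

module _ {L : Set} where
  open PermutationReasoning

  Forest : Set
  Forest = List (Tree L)

  -- rhs for the virtual root above ts, without the graftings at that root.
  rhsF : Forest → Tree L → List (Forest × Tree L)
  rhsF ts S = replicate (sizeF ts) (ts , S) ++ concatMap₁ (graftF ts) (cuts S)
    ++ concatMap₁ (λ r → graftF r S) (cutsF ts) ++ concatMap₂ (_↶ S) (cutsF ts)

  concatMap-cutsF-∷ˡ : (xs : List (Tree L)) (us : Forest) →
    concatMap (λ x → cutsF (x ∷ us)) xs
    ↭ map (us ,_) xs ++ map (map₁ (_∷ us)) (Δ xs) ++ concatMap₁ (λ r → map (_∷ r) xs) (cutsF us)
  concatMap-cutsF-∷ˡ xs us = begin
    concatMap (λ x → (us , x) ∷ (map (map₁ (_∷ us)) (cuts x) ++ map (map₁ (x ∷_)) (cutsF us))) xs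
      ↭⟨ concatMap-∷-↭ (us ,_) _ xs ⟩
    map (us ,_) xs ++ concatMap (λ x → map (map₁ (_∷ us)) (cuts x) ++ map (map₁ (x ∷_)) (cutsF us)) xs
      ↭⟨ ++⁺ˡ (map (us ,_) xs) (concatMap-++-↭ _ _ xs) ⟩
    map (us ,_) xs ++ concatMap (map (map₁ (_∷ us)) ∘ cuts) xs
      ++ concatMap (λ x → map (map₁ (x ∷_)) (cutsF us)) xs
      ↭⟨ ++⁺ˡ (map (us ,_) xs) (++⁺ (↭-reflexive (sym (map-concatMap (map₁ (_∷ us)) cuts xs)))
           (concatMap-map-comm (λ x → map₁ (x ∷_)) xs (cutsF us))) ⟩
    map (us ,_) xs ++ map (map₁ (_∷ us)) (Δ xs)
      ++ concatMap (λ (r , l) → map (λ x → (x ∷ r , l)) xs) (cutsF us)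
      ≡⟨ cong (λ zs → map (us ,_) xs ++ map (map₁ (_∷ us)) (Δ xs) ++ zs)
           (concatMap-cong (λ _ → map-∘ xs) (cutsF us)) ⟩
    map (us ,_) xs ++ map (map₁ (_∷ us)) (Δ xs) ++ concatMap₁ (λ r → map (_∷ r) xs) (cutsF us) ∎

  concatMap-cutsF-∷ʳ : (t : Tree L) (fs : List Forest) →
    concatMap (λ f → cutsF (t ∷ f)) fs
    ↭ map (_, t) fs ++ concatMap₁ (λ r → map (r ∷_) fs) (cuts t) ++ map (map₁ (t ∷_)) (concatMap cutsF fs)
  concatMap-cutsF-∷ʳ t fs = begin
    concatMap (λ f → (f , t) ∷ (map (map₁ (_∷ f)) (cuts t) ++ map (map₁ (t ∷_)) (cutsF f))) fs
      ↭⟨ concatMap-∷-↭ (_, t) _ fs ⟩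
    map (_, t) fs ++ concatMap (λ f → map (map₁ (_∷ f)) (cuts t) ++ map (map₁ (t ∷_)) (cutsF f)) fs
      ↭⟨ ++⁺ˡ (map (_, t) fs) (concatMap-++-↭ _ _ fs) ⟩
    map (_, t) fs ++ concatMap (λ f → map (map₁ (_∷ f)) (cuts t)) fs
      ++ concatMap (map (map₁ (t ∷_)) ∘ cutsF) fs
      ↭⟨ ++⁺ˡ (map (_, t) fs) (++⁺ (concatMap-map-comm (λ f → map₁ (_∷ f)) fs (cuts t))
           (↭-reflexive (sym (map-concatMap (map₁ (t ∷_)) cutsF fs)))) ⟩
    map (_, t) fs ++ concatMap (λ (r , l) → map (λ f → (r ∷ f , l)) fs) (cuts t)
      ++ map (map₁ (t ∷_)) (concatMap cutsF fs)
      ≡⟨ cong (λ zs → map (_, t) fs ++ zs ++ map (map₁ (t ∷_)) (concatMap cutsF fs))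
           (concatMap-cong (λ _ → map-∘ fs) (cuts t)) ⟩
    map (_, t) fs ++ concatMap₁ (λ r → map (r ∷_) fs) (cuts t) ++ map (map₁ (t ∷_)) (concatMap cutsF fs) ∎

  module GraftCons (t : Tree L) (us : Forest) (S : Tree L) where
    h : Tree L × Tree L → Forest × Tree L
    h = map₁ (_∷ us)
    k : Forest × Tree L → Forest × Tree L
    k = map₁ (t ∷_)
    M₁ M₃ M₄ M₅ R₁ A₁ B₁ C₁ R₂ A₂ B₂ C₂ : List (Forest × Tree L)
    M₁ = map (us ,_) (t ↶ S)
    M₃ = concatMap₁ (λ r → map (_∷ r) (t ↶ S)) (cutsF us)
    M₄ = map (_, t) (graftF us S)
    M₅ = concatMap₁ (λ r → map (r ∷_) (graftF us S)) (cuts t)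
    R₁ = replicate (size t) (t ∷ us , S)
    A₁ = concatMap₁ (map (_∷ us) ∘ (t ↶_)) (cuts S)
    B₁ = concatMap₁ (map (_∷ us) ∘ (_↶ S)) (cuts t)
    C₁ = concatMap₂ (_↶ S) (map h (cuts t))
    R₂ = replicate (sizeF us) (t ∷ us , S)
    A₂ = concatMap₁ (map (t ∷_) ∘ graftF us) (cuts S)
    B₂ = concatMap₁ (map (t ∷_) ∘ (λ r → graftF r S)) (cutsF us)
    C₂ = concatMap₂ (_↶ S) (map k (cutsF us))

    graftS : concatMap₁ (λ r → graftF r S) (cutsF (t ∷ us)) ↭ M₄ ++ (B₁ ++ M₅) ++ (M₃ ++ B₂)
    graftS = ++⁺ˡ M₄ (↭-trans
      (↭-reflexive (trans (concatMap-++ _ (map h (cuts t)) (map k (cutsF us)))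
        (cong₂ _++_ (concatMap₁-map₁ (λ r → graftF r S) (_∷ us) (cuts t))
                    (concatMap₁-map₁ (λ r → graftF r S) (t ∷_) (cutsF us)))))
      (++⁺ (concatMap₁-++ _ _ (cuts t)) (concatMap₁-++ _ _ (cutsF us))))

    graftCut : concatMap₂ (_↶ S) (cutsF (t ∷ us)) ≡ M₁ ++ C₁ ++ C₂
    graftCut = cong (M₁ ++_) (concatMap-++ _ (map h (cuts t)) (map k (cutsF us)))

    rhsF-∷ : rhsF (t ∷ us) S ↭ (R₁ ++ R₂) ++ (A₁ ++ A₂) ++ (M₄ ++ (B₁ ++ M₅) ++ (M₃ ++ B₂)) ++ (M₁ ++ C₁ ++ C₂)
    rhsF-∷ = ++⁺ (↭-reflexive (replicate-+ (size t) (sizeF us) (t ∷ us , S)))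
               (++⁺ (concatMap₁-++ _ _ (cuts S)) (++⁺ graftS (↭-reflexive graftCut)))

  mutual
    Δ-↶ : (T S : Tree L) → Δ (T ↶ S) ↭ rhs T S
    Δ-↶ T@(node a ts) S = begin
      map g (cutsF (S ∷ ts)) ++ concatMap cuts (map (node a) (graftF ts S))
        ≡⟨ cong₂ _++_ rootCuts (trans (concatMap-map cuts (node a) (graftF ts S))
                                       (sym (map-concatMap g cutsF (graftF ts S)))) ⟩
      (T , S) ∷ (X₁ ++ X₂) ++ map g (concatMap cutsF (graftF ts S))
        ↭⟨ prep (T , S) (++⁺ˡ (X₁ ++ X₂) (map⁺ g (cutsF-graftF ts S))) ⟩
      (T , S) ∷ (X₁ ++ X₂) ++ map g (rhsF ts S)
        ≡⟨ cong (λ zs → (T , S) ∷ (X₁ ++ X₂) ++ zs)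
             (map-map₁-terms (node a) (sizeF ts) (ts , S) (graftF ts) (cuts S) (λ r → graftF r S) (_↶ S) (cutsF ts)) ⟩
      (T , S) ∷ (X₁ ++ X₂) ++ (R ++ Y₁ ++ Y₂ ++ Z)
        ↭⟨ prep (T , S) (solve 6 (λ x₁ x₂ r y₁ y₂ z → (x₁ ⊕ x₂) ⊕ (r ⊕ y₁ ⊕ y₂ ⊕ z) ⊜ r ⊕ (x₁ ⊕ y₁) ⊕ (x₂ ⊕ y₂) ⊕ z)
             ↭-refl X₁ X₂ R Y₁ Y₂ Z) ⟩
      (T , S) ∷ R ++ (X₁ ++ Y₁) ++ (X₂ ++ Y₂) ++ Z
        ↭⟨ ↭-sym (++⁺ˡ ((T , S) ∷ R) (++⁺ (concatMap₁-∷ _ _ (cuts S)) (++⁺ graftS ↭-refl))) ⟩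
      rhs T S ∎
      where
      open CommutativeMonoidSolver (++-commutativeMonoid {A = Tree L × Tree L}) using (solve; _⊕_; _⊜_)
      g : Forest × Tree L → Tree L × Tree L
      g = map₁ (node a)
      X₁ X₂ R Y₁ Y₂ Z : List (Tree L × Tree L)
      X₁ = map (map₁ (λ r → node a (r ∷ ts))) (cuts S)
      X₂ = map (map₁ (λ rs → node a (S ∷ rs))) (cutsF ts)
      R  = replicate (sizeF ts) (T , S)
      Y₁ = concatMap₁ (map (node a) ∘ graftF ts) (cuts S)
      Y₂ = concatMap₁ (map (node a) ∘ (λ rs → graftF rs S)) (cutsF ts)
      Z  = concatMap₂ (_↶ S) (cuts T)
      rootCuts : map g (cutsF (S ∷ ts)) ≡ (T , S) ∷ (X₁ ++ X₂)
      rootCuts = cong ((T , S) ∷_) (trans (map-++ g (map (map₁ (_∷ ts)) (cuts S)) (map (map₁ (S ∷_)) (cutsF ts)))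
        (cong₂ _++_ (sym (map-∘ (cuts S))) (sym (map-∘ (cutsF ts)))))
      graftS : concatMap₁ (_↶ S) (cuts T) ↭ X₂ ++ Y₂
      graftS = ↭-trans (↭-reflexive (concatMap₁-map₁ (_↶ S) (node a) (cutsF ts))) (concatMap₁-∷ _ _ (cutsF ts))

    cutsF-graftF : (ts : Forest) (S : Tree L) → concatMap cutsF (graftF ts S) ↭ rhsF ts S
    cutsF-graftF [] S = ↭-reflexive (sym (trans (++-identityʳ _) (concatMap-const-[] (cuts S))))
    cutsF-graftF (t ∷ us) S = begin
      concatMap cutsF (map (_∷ us) (t ↶ S) ++ map (t ∷_) (graftF us S))
        ≡⟨ trans (concatMap-++ cutsF (map (_∷ us) (t ↶ S)) _)
             (cong₂ _++_ (concatMap-map cutsF (_∷ us) (t ↶ S)) (concatMap-map cutsF (t ∷_) (graftF us S))) ⟩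
      concatMap (λ x → cutsF (x ∷ us)) (t ↶ S) ++ concatMap (λ f → cutsF (t ∷ f)) (graftF us S)
        ↭⟨ ++⁺ (concatMap-cutsF-∷ˡ (t ↶ S) us) (concatMap-cutsF-∷ʳ t (graftF us S)) ⟩
      (M₁ ++ map h (Δ (t ↶ S)) ++ M₃) ++ (M₄ ++ M₅ ++ map k (concatMap cutsF (graftF us S)))
        ↭⟨ ++⁺ (++⁺ˡ M₁ (++⁺ʳ M₃ (map⁺ h (Δ-↶ t S)))) (++⁺ˡ M₄ (++⁺ˡ M₅ (map⁺ k (cutsF-graftF us S)))) ⟩
      (M₁ ++ map h (rhs t S) ++ M₃) ++ (M₄ ++ M₅ ++ map k (rhsF us S))
        ≡⟨ cong₂ (λ xs ys → (M₁ ++ xs ++ M₃) ++ (M₄ ++ M₅ ++ ys))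
             (map-map₁-terms (_∷ us) (size t) (t , S) (t ↶_) (cuts S) (_↶ S) (_↶ S) (cuts t))
             (map-map₁-terms (t ∷_) (sizeF us) (us , S) (graftF us) (cuts S) (λ r → graftF r S) (_↶ S) (cutsF us)) ⟩
      (M₁ ++ (R₁ ++ A₁ ++ B₁ ++ C₁) ++ M₃) ++ (M₄ ++ M₅ ++ (R₂ ++ A₂ ++ B₂ ++ C₂))
        ↭⟨ solve 12 (λ m₁ r₁ a₁ b₁ c₁ m₃ m₄ m₅ r₂ a₂ b₂ c₂ →
                (m₁ ⊕ (r₁ ⊕ a₁ ⊕ b₁ ⊕ c₁) ⊕ m₃) ⊕ (m₄ ⊕ m₅ ⊕ (r₂ ⊕ a₂ ⊕ b₂ ⊕ c₂))
              ⊜ (r₁ ⊕ r₂) ⊕ (a₁ ⊕ a₂) ⊕ (m₄ ⊕ (b₁ ⊕ m₅) ⊕ (m₃ ⊕ b₂)) ⊕ (m₁ ⊕ c₁ ⊕ c₂))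
             ↭-refl M₁ R₁ A₁ B₁ C₁ M₃ M₄ M₅ R₂ A₂ B₂ C₂ ⟩
      (R₁ ++ R₂) ++ (A₁ ++ A₂) ++ (M₄ ++ (B₁ ++ M₅) ++ (M₃ ++ B₂)) ++ (M₁ ++ C₁ ++ C₂)
        ↭⟨ ↭-sym rhsF-∷ ⟩
      rhsF (t ∷ us) S ∎
      where
      open GraftCons t us S
      open CommutativeMonoidSolver (++-commutativeMonoid {A = Forest × Tree L}) using (solve; _⊕_; _⊜_)

mutual
  ≅-refl : {L : Set} (t : Tree L) → t ≅ t
  ≅-refl (node a ts) = node≅ refl (Homogeneous.refl (≅-reflF ts))

  ≅-reflF : {L : Set} (ts : List (Tree L)) → Pointwise _≅_ ts ts
  ≅-reflF []       = []
  ≅-reflF (t ∷ ts) = ≅-refl t ∷ ≅-reflF ts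

≡⇒≅² : {L : Set} {p q : Tree L × Tree L} → p ≡ q → p ≅² q
≡⇒≅² {p = s , t} refl = ≅-refl s , ≅-refl t

proposition2p2p2 : {L : Set} (T S : Tree L) →
    Δ (T ↶ S) ≈₂ rhs T S
proposition2p2p2 T S = Homogeneous.map ≡⇒≅² (↭⇒↭ₛ (Δ-↶ T S))
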